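{- Let $\Gamma$ be a sub-semigroup of a group $G$. If $\Gamma$ is strongly automatic, then $\Gamma$ is automatic.
   Context: Let $e$ be the identity of $G$; a letter $e$ in a word is evaluated as the identity. For a finite generating set $\Sigma$ of $\Gamma$, the set of relations is $L^{rel} = \{(u_1,v_1)\cdots(u_n,v_n) \in (\Sigma \times (\Sigma\cup\{e\}))^* : u_1\cdots u_n = v_1\cdots v_n \text{ in } G\}$; $\Gamma$ is strongly automatic if for some finite generating set $\Sigma$ this is a rational (regular) language. For languages $L$ over $\Sigma_1$ and $K$ over $\Sigma_2$, $L \times K = \{(a_1,b_1)\cdots(a_n,b_n) : a_1\cdots a_n \in L, b_1\cdots b_n \in K\}$. $\Gamma$ is automatic if there exist a finite generating set $\Sigma$, a finite automaton $\mathcal{A}^{red}$ over $\Sigma$ whose language $L^{red}$ satisfies: for every $\gamma \in \Gamma$ there is a unique $u \in L^{red}$ with $u = \gamma$ in $\Gamma$; and for each $g \in \Sigma$ a finite automaton $\mathcal{A}^g$ over $(\Sigma\cup\{e\})\times(\Sigma\cup\{e\})$ whose language is the set of words $(u_1,v_1)\cdots(u_n,v_n) \in (L^{red}g \times L^{red}e^*) \cup (L^{red}g e^* \times L^{red})$ with $u_1\cdots u_n = v_1\cdots v_n$ in $\Gamma$. -}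

module Defs where

open import Level using (Level; _⊔_)
open import Algebra.Bundles using (Group)
open import Data.Nat using (ℕ)
open import Data.Fin using (Fin)
open import Data.Bool using (Bool; T)
open import Data.Maybe using (Maybe; just; nothing; maybe)
open import Data.List using (List; []; _∷_; map; _++_; replicate; foldr)
open import Data.Product using (Σ; _×_; _,_; proj₁; proj₂; ∃; ∃-syntax)
open import Data.Sum using (_⊎_)
open import Relation.Unary using (Pred)
open import Relation.Binary.PropositionalEquality using (_≡_; _≢_)
open import Function.Bundles using (_⇔_)

record DFA (A : Set) : Set where
  field
    nStates : ℕ
    start   : Fin nStates
    step    : Fin nStates → A → Fin nStates
    final   : Fin nStates → Bool

  run : Fin nStates → List A → Fin nStates
  run q []       = q
  run q (a ∷ w)  = run (step q a) w

  Accepts : List A → Set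
  Accepts w = T (final (run start w))

open DFA public using (Accepts)

Regular : ∀ {ℓ} {A : Set} → Pred (List A) ℓ → Set ℓ
Regular {A = A} L = Σ (DFA A) λ M → ∀ w → Accepts M w ⇔ L w

module _ {c ℓ : Level} (G : Group c ℓ) where
  open Group G

  record IsSubSemigroup {ℓ′} (Γ : Pred Carrier ℓ′) : Set (c ⊔ ℓ ⊔ ℓ′) where
    field
      resp : ∀ {x y} → x ≈ y → Γ x → Γ y
      closed : ∀ {x y} → Γ x → Γ y → Γ (x ∙ y)

  -- evaluation of a word over Σ ∪ {e}; the letter e (nothing) is the identity
  evalE : ∀ {n} → (Fin n → Carrier) → List (Maybe (Fin n)) → Carrier
  evalE gens = foldr (λ a acc → maybe gens ε a ∙ acc) ε

  evalΣ : ∀ {n} → (Fin n → Carrier) → List (Fin n) → Carrier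
  evalΣ gens w = evalE gens (map just w)

  record IsGeneratingSet {ℓ′} (Γ : Pred Carrier ℓ′) {n : ℕ}
         (gens : Fin n → Carrier) : Set (c ⊔ ℓ ⊔ ℓ′) where
    field
      inΓ : ∀ i → Γ (gens i)
      generates : ∀ γ → Γ γ →
        Σ (List (Fin n)) λ w → (w ≢ []) × (evalΣ gens w ≈ γ)

  Lrel : ∀ {n} → (Fin n → Carrier) → Pred (List (Fin n × Maybe (Fin n))) ℓ
  Lrel gens w = evalΣ gens (map proj₁ w) ≈ evalE gens (map proj₂ w)

  StronglyAutomatic : ∀ {ℓ′} → Pred Carrier ℓ′ → Set (c ⊔ ℓ ⊔ ℓ′)
  StronglyAutomatic Γ =
    Σ ℕ λ n → Σ (Fin n → Carrier) λ gens →
      IsGeneratingSet Γ gens × Regular (Lrel gens)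

  InRedPad : ∀ {n} → DFA (Fin n) → Pred (List (Maybe (Fin n))) _
  InRedPad Ared w = Σ (List (Fin _)) λ r → Σ ℕ λ k →
      Accepts Ared r × (w ≡ map just r ++ replicate k nothing)

  InRedGPad : ∀ {n} → DFA (Fin n) → Fin n → Pred (List (Maybe (Fin n))) _
  InRedGPad Ared g w = Σ (List (Fin _)) λ r → Σ ℕ λ k →
      Accepts Ared r × (w ≡ map just r ++ (just g ∷ replicate k nothing))

  InRed : ∀ {n} → DFA (Fin n) → Pred (List (Maybe (Fin n))) _
  InRed Ared w = Σ (List (Fin _)) λ r → Accepts Ared r × (w ≡ map just r)

  InRedG : ∀ {n} → DFA (Fin n) → Fin n → Pred (List (Maybe (Fin n))) _
  InRedG Ared g w = Σ (List (Fin _)) λ r →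
      Accepts Ared r × (w ≡ map just r ++ (just g ∷ []))

  Lmult : ∀ {n} → (Fin n → Carrier) → DFA (Fin n) → Fin n →
          Pred (List (Maybe (Fin n) × Maybe (Fin n))) ℓ
  Lmult gens Ared g w =
    ( (InRedG Ared g (map proj₁ w) × InRedPad Ared (map proj₂ w))
    ⊎ (InRedGPad Ared g (map proj₁ w) × InRed Ared (map proj₂ w)) )
    × (evalE gens (map proj₁ w) ≈ evalE gens (map proj₂ w))

  Automatic : ∀ {ℓ′} → Pred Carrier ℓ′ → Set (c ⊔ ℓ ⊔ ℓ′)
  Automatic Γ =
    Σ ℕ λ n → Σ (Fin n → Carrier) λ gens → IsGeneratingSet Γ gens ×
    Σ (DFA (Fin n)) λ Ared →
      (∀ γ → Γ γ → Σ (List (Fin n)) λ u →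
         (Accepts Ared u × evalΣ gens u ≈ γ) ×
         (∀ u′ → Accepts Ared u′ → evalΣ gens u′ ≈ γ → u′ ≡ u)) ×
      (∀ (g : Fin n) → Σ (DFA (Maybe (Fin n) × Maybe (Fin n))) λ Ag →
         ∀ w → Accepts Ag w ⇔ Lmult gens Ared g w)

-- Use shortlex-least words as normal forms: u is reducible when some v ≺ u has the same value
-- in G. The padded pairs (u, v) with v ≺ u form a regular language, so the reducible words are
-- the first-track projection of its intersection with L^rel; projections of regular languages
-- are regular (subset construction), hence so is L^red, the complement. Since ≺ is well-founded
-- and total and reducibility is decidable, every element has exactly one irreducible
-- representative. In the multiplier languages the shape conditions are regular operations
-- (padding, appending g, preimages of the tracks) applied to L^red, and on words of these
-- shapes one track carries no padding symbol, so the condition u = v in G is the image of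
-- L^rel under a letter embedding (with the tracks swapped in the second case).

module Submission where

open import Defs
open import Level using (Level)
open import Algebra.Bundles using (Group)
open import Relation.Unary using (Pred; Decidable; ∁; _∩_; _∪_)
open import Data.Bool using (Bool; true; false; T; not; _∧_; _∨_)
open import Data.Bool.Properties using (T?; T-∧; T-∨)
open import Data.Fin using (Fin; zero; suc)
import Data.Fin.Properties as Fin
import Data.Fin.Induction as Fin
open import Data.Fin.Properties using (*↔×; 2↔Bool; any?)
open import Data.List using (List; []; _∷_; map; foldl; _++_; _∷ʳ_; replicate; length; _∷ʳ′_; initLast)
open import Data.List.Properties
  using (foldl-++; foldl-map; foldl-∷ʳ; ∷-injective; ∷ʳ-injective; map-++; map-∘; ++-assoc)
open import Data.Maybe using (Maybe; just; nothing; maybe)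
import Data.Maybe.Properties as Maybe
open import Data.Nat using (ℕ; zero; suc; _*_; s≤s; z≤n; _≤_; _∸_)
import Data.Nat as ℕ
import Data.Nat.Properties as ℕ
import Data.Nat.Induction as ℕ
open import Data.Product using (Σ; ∃; _×_; _,_; proj₁; proj₂; map₁; swap)
open import Data.Product.Function.NonDependent.Propositional using (_×-↔_)
import Data.Product.Properties as Product
open import Data.Product.Relation.Binary.Lex.Strict using (×-Lex; ×-wellFounded)
import Data.Sum as Sum
open import Data.Sum using (_⊎_; inj₁; inj₂)
open import Data.Vec using (Vec; []; _∷_; lookup; tabulate; uncons)
open import Data.Vec.Properties using (lookup∘tabulate)
open import Function using (_∘_; _on_; id)
open import Function.Bundles using (_↔_; _⇔_; mk⇔; mk↔ₛ′; Inverse; Equivalence)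
open import Function.Construct.Identity using (↔-id)
open import Function.Properties.Inverse using (↔-sym; ↔-trans)
open import Function.Properties.Equivalence using () renaming (trans to ⇔-trans; sym to ⇔-sym)
open import Induction.WellFounded using (WellFounded; WfRec; Acc; acc)
open import Relation.Binary using (Rel; IsEquivalence; Trichotomous; tri<; tri≈; tri>)
import Relation.Binary.Construct.On as On
open import Relation.Binary.Definitions using (DecidableEquality)
open import Relation.Binary.PropositionalEquality using (_≡_; refl; sym; trans; cong; subst)
open import Relation.Nullary using (¬_; Dec; yes; no; ⌊_⌋; toWitness; fromWitness; contradiction)
open import Relation.Nullary.Decidable using (_×-dec_)
import Relation.Nullary.Decidable as Dec

private
  variable
    ℓ ℓ′ : Level
    A B : Set

Finite : Set → Set
Finite S = Σ ℕ λ k → S ↔ Fin k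

Fin-finite : ∀ k → Finite (Fin k)
Fin-finite k = k , ↔-id (Fin k)

Bool-finite : Finite Bool
Bool-finite = 2 , ↔-sym 2↔Bool

×-finite : ∀ {S S′} → Finite S → Finite S′ → Finite (S × S′)
×-finite (k , f) (k′ , f′) = k * k′ , ↔-trans (f ×-↔ f′) (↔-sym *↔×)

Maybe-finite : ∀ {S} → Finite S → Finite (Maybe S)
Maybe-finite {S} (k , f) = suc k , mk↔ₛ′ to from to∘from from∘to
  where
  open Inverse f renaming (to to toₛ; from to fromₛ)
  to : Maybe S → Fin (suc k)
  to nothing  = zero
  to (just s) = suc (toₛ s)
  from : Fin (suc k) → Maybe S
  from zero    = nothing
  from (suc i) = just (fromₛ i)
  to∘from : ∀ i → to (from i) ≡ i
  to∘from zero    = refl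
  to∘from (suc i) = cong suc (strictlyInverseˡ i)
  from∘to : ∀ s → from (to s) ≡ s
  from∘to nothing  = refl
  from∘to (just s) = cong just (strictlyInverseʳ s)

Vec-Bool-finite : ∀ k → Finite (Vec Bool k)
Vec-Bool-finite zero    = 1 , mk↔ₛ′ (λ _ → zero) (λ _ → []) (λ { zero → refl }) (λ { [] → refl })
Vec-Bool-finite (suc k) with ×-finite Bool-finite (Vec-Bool-finite k)
... | m , f = m , ↔-trans uncons↔ f
  where
  uncons↔ : Vec Bool (suc k) ↔ (Bool × Vec Bool k)
  uncons↔ = mk↔ₛ′ uncons (λ (b , bs) → b ∷ bs) (λ _ → refl) (λ { (b ∷ bs) → refl })

record Automaton (A : Set) : Set₁ where
  field
    State  : Set
    finite : Finite State
    start  : State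
    step   : State → A → State
    accept : State → Bool

  run : State → List A → State
  run = foldl step

  Lang : List A → Set
  Lang w = T (accept (run start w))

open Automaton using (Lang)

Recognises : Automaton A → Pred (List A) ℓ → Set ℓ
Recognises M L = ∀ w → Lang M w ⇔ L w

module _ (M : Automaton A) where
  open Automaton M hiding (Lang)
  open Inverse (proj₂ finite) using (to; from; strictlyInverseʳ)

  toDFA : DFA A
  toDFA = record
    { nStates = proj₁ finite
    ; start   = to start
    ; step    = λ i a → to (step (from i) a)
    ; final   = accept ∘ from
    }

  toDFA-run : ∀ q w → DFA.run toDFA (to q) w ≡ to (run q w)
  toDFA-run q []      = refl
  toDFA-run q (a ∷ w) rewrite strictlyInverseʳ q = toDFA-run (step q a) w

  recognised⇒regular : {L : Pred (List A) ℓ} → Recognises M L → Regular L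
  recognised⇒regular rec = toDFA , λ w → ⇔-trans (accepts⇔ w) (rec w)
    where
    accepts⇔ : ∀ w → Accepts toDFA w ⇔ Lang M w
    accepts⇔ w rewrite toDFA-run start w | strictlyInverseʳ (run start w) = mk⇔ id id

fromDFA : DFA A → Automaton A
fromDFA D = record
  { State  = Fin nStates
  ; finite = Fin-finite nStates
  ; start  = start
  ; step   = step
  ; accept = final
  }
  where open DFA D

DFA-run≡foldl : (D : DFA A) → ∀ q w → DFA.run D q w ≡ foldl (DFA.step D) q w
DFA-run≡foldl D q []      = refl
DFA-run≡foldl D q (a ∷ w) = DFA-run≡foldl D (DFA.step D q a) w

regular⇒recognised : {L : Pred (List A) ℓ} → Regular L → Σ (Automaton A) λ M → Recognises M L
regular⇒recognised (D , accepted⇔) = fromDFA D , λ w →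
  subst (λ q → T (DFA.final D q) ⇔ _) (DFA-run≡foldl D (DFA.start D) w) (accepted⇔ w)

Regular-resp : {L : Pred (List A) ℓ} {K : Pred (List A) ℓ′} →
  (∀ w → L w ⇔ K w) → Regular L → Regular K
Regular-resp L⇔K (D , accepted⇔) = D , λ w → ⇔-trans (accepted⇔ w) (L⇔K w)

Regular-decidable : {L : Pred (List A) ℓ} → Regular L → Decidable L
Regular-decidable (D , accepted⇔) w = Dec.map (accepted⇔ w) (T? _)

Regular-Accepts : (D : DFA A) → Regular (Accepts D)
Regular-Accepts D = D , λ _ → mk⇔ id id

T-not : ∀ {b} → T (not b) ⇔ (¬ T b)
T-not {false} = mk⇔ (λ _ ()) _
T-not {true}  = mk⇔ (λ ()) (λ ¬t → ¬t _)

Regular-∁ : {L : Pred (List A) ℓ} → Regular L → Regular (∁ L)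
Regular-∁ reg with regular⇒recognised reg
... | M , rec = recognised⇒regular (record M { accept = not ∘ Automaton.accept M }) λ w →
  mk⇔ (λ t l → Equivalence.to T-not t (Equivalence.from (rec w) l))
      (λ ¬l → Equivalence.from T-not (¬l ∘ Equivalence.to (rec w)))

product : (Bool → Bool → Bool) → Automaton A → Automaton A → Automaton A
product _⊕_ M N = record
  { State  = M.State × N.State
  ; finite = ×-finite M.finite N.finite
  ; start  = M.start , N.start
  ; step   = λ (p , q) a → M.step p a , N.step q a
  ; accept = λ (p , q) → M.accept p ⊕ N.accept q
  }
  where module M = Automaton M; module N = Automaton N

run-product : ∀ _⊕_ (M N : Automaton A) p q w →
  Automaton.run (product _⊕_ M N) (p , q) w ≡ (Automaton.run M p w , Automaton.run N q w)
run-product _⊕_ M N p q []      = refl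
run-product _⊕_ M N p q (a ∷ w) = run-product _⊕_ M N _ _ w

Lang-product : ∀ _⊕_ (M N : Automaton A) w →
  Lang (product _⊕_ M N) w ≡ T (Automaton.accept M (Automaton.run M (Automaton.start M) w)
                                ⊕ Automaton.accept N (Automaton.run N (Automaton.start N) w))
Lang-product _⊕_ M N w =
  cong (λ (p , q) → T (Automaton.accept M p ⊕ Automaton.accept N q))
       (run-product _⊕_ M N (Automaton.start M) (Automaton.start N) w)

Regular-∩ : {L : Pred (List A) ℓ} {K : Pred (List A) ℓ′} → Regular L → Regular K → Regular (L ∩ K)
Regular-∩ regL regK with regular⇒recognised regL | regular⇒recognised regK
... | M , recM | N , recN = recognised⇒regular (product _∧_ M N) λ w →
  subst (_⇔ _) (sym (Lang-product _∧_ M N w))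
    (⇔-trans T-∧ (mk⇔ (λ (m , n) → Equivalence.to (recM w) m , Equivalence.to (recN w) n)
                      (λ (l , k) → Equivalence.from (recM w) l , Equivalence.from (recN w) k)))

Regular-∪ : {L : Pred (List A) ℓ} {K : Pred (List A) ℓ′} → Regular L → Regular K → Regular (L ∪ K)
Regular-∪ regL regK with regular⇒recognised regL | regular⇒recognised regK
... | M , recM | N , recN = recognised⇒regular (product _∨_ M N) λ w →
  subst (_⇔ _) (sym (Lang-product _∨_ M N w))
    (⇔-trans T-∨ (mk⇔ (Sum.map (Equivalence.to (recM w)) (Equivalence.to (recN w)))
                      (Sum.map (Equivalence.from (recM w)) (Equivalence.from (recN w)))))

Regular-preimage : (f : B → A) {L : Pred (List A) ℓ} → Regular L → Regular (L ∘ map f)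
Regular-preimage f reg with regular⇒recognised reg
... | M , rec = recognised⇒regular M∘f λ w →
  subst (λ q → T (accept q) ⇔ _) (foldl-map step f start w) (rec (map f w))
  where
  open Automaton M hiding (Lang)
  M∘f : Automaton _
  M∘f = record { State = State ; finite = finite ; start = start
               ; step = λ q b → step q (f b) ; accept = accept }

Image : (A → B) → Pred (List A) ℓ → Pred (List B) ℓ
Image e L w = Σ (List _) λ v → L v × w ≡ map e v

any?-finite : ∀ {S} → Finite S → {P : Pred S ℓ} → Decidable P → Dec (∃ P)
any?-finite (k , f) {P} P? = Dec.map (mk⇔ (λ (i , p) → from i , p) (λ (s , p) → to s , p′ s p))
                                     (any? (P? ∘ from))
  where
  open Inverse f using (to; from; strictlyInverseʳ)
  p′ : ∀ s → P s → P (from (to s))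
  p′ s = subst P (sym (strictlyInverseʳ s))

module SubsetConstruction (finB : Finite B) (f : B → A) (_≟_ : DecidableEquality A) (D : DFA B) where
  open DFA D hiding (Accepts)

  StateSet : Set
  StateSet = Vec Bool nStates

  _∈_ : Fin nStates → StateSet → Set
  q ∈ S = T (lookup S q)

  ⟦_⟧ : {P : Pred (Fin nStates) ℓ} → Decidable P → StateSet
  ⟦ P? ⟧ = tabulate (⌊_⌋ ∘ P?)

  ∈⟦⟧ : {P : Pred (Fin nStates) ℓ} (P? : Decidable P) → ∀ {q} → q ∈ ⟦ P? ⟧ ⇔ P q
  ∈⟦⟧ P? {q} rewrite lookup∘tabulate (⌊_⌋ ∘ P?) q = mk⇔ toWitness fromWitness

  Successor : StateSet → A → Pred (Fin nStates) _
  Successor S a q′ = ∃ λ q → q ∈ S × ∃ λ b → f b ≡ a × step q b ≡ q′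

  successor? : ∀ S a → Decidable (Successor S a)
  successor? S a q′ =
    any? λ q → T? (lookup S q) ×-dec any?-finite finB λ b → (f b ≟ a) ×-dec (step q b Fin.≟ q′)

  next : StateSet → A → StateSet
  next S a = ⟦ successor? S a ⟧

  Final : StateSet → Set
  Final S = ∃ λ q → q ∈ S × T (final q)

  final? : ∀ S → Dec (Final S)
  final? S = any? λ q → T? (lookup S q) ×-dec T? (final q)

  subsets : Automaton A
  subsets = record
    { State  = StateSet
    ; finite = Vec-Bool-finite nStates
    ; start  = ⟦ (Fin._≟ start) ⟧
    ; step   = next
    ; accept = ⌊_⌋ ∘ final?
    }

  Reachable : StateSet → List A → Pred (Fin nStates) _
  Reachable S u q′ = ∃ λ q → q ∈ S × ∃ λ w → u ≡ map f w × run q w ≡ q′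

  reachable⁺ : ∀ S u {q′} → q′ ∈ foldl next S u → Reachable S u q′
  reachable⁺ S []      q′∈S = _ , q′∈S , [] , refl , refl
  reachable⁺ S (a ∷ u) q′∈ with reachable⁺ (next S a) u q′∈
  ... | q₁ , q₁∈ , w , refl , r with Equivalence.to (∈⟦⟧ _) q₁∈
  ...   | q , q∈S , b , refl , refl = q , q∈S , b ∷ w , refl , r

  reachable⁻ : ∀ S u {q′} → Reachable S u q′ → q′ ∈ foldl next S u
  reachable⁻ S []      (q , q∈S , [] , refl , refl) = q∈S
  reachable⁻ S (a ∷ u) (q , q∈S , b ∷ w , u≡ , r) with ∷-injective u≡
  ... | refl , refl = reachable⁻ (next S a) u
        (step q b , Equivalence.from (∈⟦⟧ _) (q , q∈S , b , refl , refl) , w , refl , r)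

  Lang-subsets : ∀ u → Lang subsets u ⇔ Image f (Accepts D) u
  Lang-subsets u = mk⇔ to from
    where
    to : Lang subsets u → Image f (Accepts D) u
    to accepted with toWitness accepted
    ... | q′ , q′∈ , fin with reachable⁺ _ u q′∈
    ...   | q , q∈ , w , u≡ , r with Equivalence.to (∈⟦⟧ _) q∈
    ...     | refl = w , subst (T ∘ final) (sym r) fin , u≡
    from : Image f (Accepts D) u → Lang subsets u
    from (w , accepted , u≡) = fromWitness
      (run start w , reachable⁻ _ u (start , Equivalence.from (∈⟦⟧ _) refl , w , u≡ , refl) , accepted)

Regular-image : Finite B → (f : B → A) → DecidableEquality A →
  {L : Pred (List B) ℓ} → Regular L → Regular (Image f L)
Regular-image finB f _≟_ (D , accepted⇔) = recognised⇒regular subsets λ u →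
  ⇔-trans (Lang-subsets u)
    (mk⇔ (λ (w , accepted , u≡) → w , Equivalence.to (accepted⇔ w) accepted , u≡)
         (λ (w , l , u≡) → w , Equivalence.from (accepted⇔ w) l , u≡))
  where open SubsetConstruction finB f _≟_ D

Snoc : Pred (List A) ℓ → A → Pred (List A) ℓ
Snoc L a w = Σ (List _) λ r → L r × w ≡ r ∷ʳ a

module _ (_≟_ : DecidableEquality A) (a : A) (M : Automaton A) where
  open Automaton M hiding (Lang)

  -- The flag records whether the last letter read was a, read from an accepting state.
  snoc : Automaton A
  snoc = record
    { State  = State × Bool
    ; finite = ×-finite finite Bool-finite
    ; start  = start , false
    ; step   = λ (q , _) x → step q x , ⌊ x ≟ a ⌋ ∧ accept q
    ; accept = proj₂
    }

  run-snoc₁ : ∀ s w → proj₁ (Automaton.run snoc s w) ≡ run (proj₁ s) w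
  run-snoc₁ s []      = refl
  run-snoc₁ s (x ∷ w) = run-snoc₁ _ w

  Lang-snoc : ∀ w → Lang snoc w ⇔ Snoc (Lang M) a w
  Lang-snoc w with initLast w
  ... | [] = mk⇔ (λ ()) λ { ([] , _ , ()) ; (_ ∷ _ , _ , ()) }
  ... | ys ∷ʳ′ y
    rewrite foldl-∷ʳ (Automaton.step snoc) (start , false) y ys
          | run-snoc₁ (start , false) ys = mk⇔ to from
    where
    to : T (⌊ y ≟ a ⌋ ∧ accept (run start ys)) → Snoc (Lang M) a (ys ∷ʳ y)
    to t with Equivalence.to (T-∧ {⌊ y ≟ a ⌋}) t
    ... | y≡a , accepted rewrite toWitness y≡a = ys , accepted , refl
    from : Snoc (Lang M) a (ys ∷ʳ y) → T (⌊ y ≟ a ⌋ ∧ accept (run start ys))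
    from (r , accepted , eq) with ∷ʳ-injective ys r eq
    ... | refl , refl = Equivalence.from T-∧ (fromWitness refl , accepted)

Regular-snoc : DecidableEquality A → (a : A) → {L : Pred (List A) ℓ} → Regular L → Regular (Snoc L a)
Regular-snoc _≟_ a reg with regular⇒recognised reg
... | M , rec = recognised⇒regular (snoc _≟_ a M) λ w →
  ⇔-trans (Lang-snoc _≟_ a M w)
    (mk⇔ (λ (r , accepted , eq) → r , Equivalence.to (rec r) accepted , eq)
         (λ (r , l , eq) → r , Equivalence.from (rec r) l , eq))

Padded : Pred (List A) ℓ → Pred (List (Maybe A)) ℓ
Padded L x = Σ (List _) λ r → Σ ℕ λ k → L r × x ≡ map just r ++ replicate k nothing

module _ (M : Automaton A) where
  open Automaton M hiding (Lang)

  -- States are the states of M, flagged once the padding has begun; nothing is a sink.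
  padStep : Maybe (State × Bool) → Maybe A → Maybe (State × Bool)
  padStep nothing            _        = nothing
  padStep (just (q , _))     nothing  = just (q , true)
  padStep (just (q , false)) (just a) = just (step q a , false)
  padStep (just (q , true))  (just a) = nothing

  padded : Automaton (Maybe A)
  padded = record
    { State  = Maybe (State × Bool)
    ; finite = Maybe-finite (×-finite finite Bool-finite)
    ; start  = just (start , false)
    ; step   = padStep
    ; accept = maybe (accept ∘ proj₁) false
    }

  private
    run′ = Automaton.run padded

  run-padded-letters : ∀ q r → run′ (just (q , false)) (map just r) ≡ just (run q r , false)
  run-padded-letters q []      = refl
  run-padded-letters q (a ∷ r) = run-padded-letters (step q a) r

  run-padded-padding : ∀ q b k → ∃ λ b′ → run′ (just (q , b)) (replicate k nothing) ≡ just (q , b′)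
  run-padded-padding q b zero    = b , refl
  run-padded-padding q b (suc k) = run-padded-padding q true k

  run-padded-sink : ∀ x → run′ nothing x ≡ nothing
  run-padded-sink []      = refl
  run-padded-sink (_ ∷ x) = run-padded-sink x

  run-padding⁻¹ : ∀ q x {s} → run′ (just (q , true)) x ≡ just s →
    Σ ℕ λ k → x ≡ replicate k nothing × proj₁ s ≡ q
  run-padding⁻¹ q []             refl = zero , refl , refl
  run-padding⁻¹ q (nothing ∷ x)  eq with run-padding⁻¹ q x eq
  ... | k , refl , q≡ = suc k , refl , q≡
  run-padding⁻¹ q (just a ∷ x)   eq with () ← trans (sym (run-padded-sink x)) eq

  run-padded⁻¹ : ∀ q x {s} → run′ (just (q , false)) x ≡ just s →
    Σ (List A) λ r → Σ ℕ λ k → x ≡ map just r ++ replicate k nothing × proj₁ s ≡ run q r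
  run-padded⁻¹ q []            refl = [] , zero , refl , refl
  run-padded⁻¹ q (nothing ∷ x) eq with run-padding⁻¹ q x eq
  ... | k , refl , q≡ = [] , suc k , refl , q≡
  run-padded⁻¹ q (just a ∷ x)  eq with run-padded⁻¹ (step q a) x eq
  ... | r , k , refl , q≡ = a ∷ r , k , refl , q≡

  Lang-padded : ∀ x → Lang padded x ⇔ Padded (Lang M) x
  Lang-padded x = mk⇔ to from
    where
    to : Lang padded x → Padded (Lang M) x
    to accepted with run′ (just (start , false)) x in eq
    ... | just (q , b) with run-padded⁻¹ start x eq
    ...   | r , k , x≡ , refl = r , k , accepted , x≡
    from : Padded (Lang M) x → Lang padded x
    from (r , k , accepted , refl)
      rewrite foldl-++ padStep (just (start , false)) (map just r) (replicate k nothing)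
            | run-padded-letters start r
            | proj₂ (run-padded-padding (run start r) false k) = accepted

Regular-padded : {L : Pred (List A) ℓ} → Regular L → Regular (Padded L)
Regular-padded reg with regular⇒recognised reg
... | M , rec = recognised⇒regular (padded M) λ x →
  ⇔-trans (Lang-padded M x)
    (mk⇔ (λ (r , k , accepted , eq) → r , k , Equivalence.to (rec r) accepted , eq)
         (λ (r , k , l , eq) → r , k , Equivalence.from (rec r) l , eq))

module Shortlex {ℓ} {A : Set} {_<_ : Rel A ℓ} (<-cmp : Trichotomous _≡_ _<_) (<-wf : WellFounded _<_) where

  -- Reverse lexicographic order on words of equal length: the last differing letter decides.
  data _<ʳ_ : Rel (List A) ℓ where
    tail< : ∀ {a b u v} → u <ʳ v → (a ∷ u) <ʳ (b ∷ v)
    head< : ∀ {a b u} → a < b → (a ∷ u) <ʳ (b ∷ u)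

  <ʳ-length : ∀ {u v} → u <ʳ v → length u ≡ length v
  <ʳ-length (tail< u<v) = cong suc (<ʳ-length u<v)
  <ʳ-length (head< _)   = refl

  <ʳ-acc : ∀ {u a} → Acc _<ʳ_ u → Acc _<_ a → Acc _<ʳ_ (a ∷ u)
  <ʳ-acc acc-u acc-a = acc (<ʳ-rec acc-u acc-a)
    where
    <ʳ-rec : ∀ {u a} → Acc _<ʳ_ u → Acc _<_ a → WfRec _<ʳ_ (Acc _<ʳ_) (a ∷ u)
    <ʳ-rec (acc rs-u) _          (tail< v<u) = <ʳ-acc (rs-u v<u) (<-wf _)
    <ʳ-rec acc-u      (acc rs-a) (head< b<a) = <ʳ-acc acc-u (rs-a b<a)

  <ʳ-wellFounded : WellFounded _<ʳ_
  <ʳ-wellFounded []      = acc λ ()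
  <ʳ-wellFounded (a ∷ u) = <ʳ-acc (<ʳ-wellFounded u) (<-wf a)

  <ʳ-trichotomy : ∀ u v → length u ≡ length v → u <ʳ v ⊎ u ≡ v ⊎ v <ʳ u
  <ʳ-trichotomy []      []      _  = inj₂ (inj₁ refl)
  <ʳ-trichotomy (a ∷ u) (b ∷ v) eq with <ʳ-trichotomy u v (ℕ.suc-injective eq)
  ... | inj₁ u<v        = inj₁ (tail< u<v)
  ... | inj₂ (inj₂ v<u) = inj₂ (inj₂ (tail< v<u))
  ... | inj₂ (inj₁ refl) with <-cmp a b
  ...   | tri< a<b _ _    = inj₁ (head< a<b)
  ...   | tri≈ _ refl _   = inj₂ (inj₁ refl)
  ...   | tri> _ _ b<a    = inj₂ (inj₂ (head< b<a))

  _≺_ : Rel (List A) ℓ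
  _≺_ = ×-Lex _≡_ ℕ._<_ _<ʳ_ on λ u → length u , u

  ≺-wellFounded : WellFounded _≺_
  ≺-wellFounded = On.wellFounded _ (×-wellFounded ℕ.<-wellFounded <ʳ-wellFounded)

  ≺-trichotomy : ∀ u v → u ≺ v ⊎ u ≡ v ⊎ v ≺ u
  ≺-trichotomy u v with ℕ.<-cmp (length u) (length v)
  ... | tri< |u|<|v| _ _ = inj₁ (inj₁ |u|<|v|)
  ... | tri> _ _ |v|<|u| = inj₂ (inj₂ (inj₁ |v|<|u|))
  ... | tri≈ _ |u|≡|v| _ with <ʳ-trichotomy u v |u|≡|v|
  ...   | inj₁ u<v        = inj₁ (inj₂ (|u|≡|v| , u<v))
  ...   | inj₂ (inj₁ u≡v) = inj₂ (inj₁ u≡v)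
  ...   | inj₂ (inj₂ v<u) = inj₂ (inj₂ (inj₂ (sym |u|≡|v| , v<u)))

  Descent : Pred (List (A × Maybe A)) ℓ
  Descent w = Σ (List A) λ v → Σ ℕ λ k →
    map proj₂ w ≡ map just v ++ replicate k nothing × v ≺ map proj₁ w

  pad : List A → List A → List (A × Maybe A)
  pad []      _       = []
  pad (a ∷ u) []      = (a , nothing) ∷ pad u []
  pad (a ∷ u) (b ∷ v) = (a , just b) ∷ pad u v

  pad-proj₁ : ∀ u v → map proj₁ (pad u v) ≡ u
  pad-proj₁ []      _       = refl
  pad-proj₁ (a ∷ u) []      = cong (a ∷_) (pad-proj₁ u [])
  pad-proj₁ (a ∷ u) (b ∷ v) = cong (a ∷_) (pad-proj₁ u v)

  pad-proj₂ : ∀ u v → length v ≤ length u →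
    map proj₂ (pad u v) ≡ map just v ++ replicate (length u ∸ length v) nothing
  pad-proj₂ []      []      _         = refl
  pad-proj₂ (a ∷ u) []      _         = cong (nothing ∷_) (pad-proj₂ u [] z≤n)
  pad-proj₂ (a ∷ u) (b ∷ v) (s≤s v≤u) = cong (just b ∷_) (pad-proj₂ u v v≤u)

  ≺⇒length≤ : ∀ {u v} → v ≺ u → length v ≤ length u
  ≺⇒length≤ (inj₁ |v|<|u|)      = ℕ.<⇒≤ |v|<|u|
  ≺⇒length≤ (inj₂ (|v|≡|u| , _)) = ℕ.≤-reflexive |v|≡|u|

  descent-pad : ∀ {u v} → v ≺ u → Descent (pad u v)
  descent-pad {u} {v} v≺u =
    v , length u ∸ length v , pad-proj₂ u v (≺⇒length≤ v≺u) , subst (v ≺_) (sym (pad-proj₁ u v)) v≺u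

  belowStep : Bool → A → A → Bool
  belowStep c a b with <-cmp b a
  ... | tri< _ _ _ = true
  ... | tri≈ _ _ _ = c
  ... | tri> _ _ _ = false

  belowStep-sound : ∀ c a b → T (belowStep c a b) → b < a ⊎ (b ≡ a × T c)
  belowStep-sound c a b t with <-cmp b a
  ... | tri< b<a _ _  = inj₁ b<a
  ... | tri≈ _ b≡a _  = inj₂ (b≡a , t)

  belowStep-< : ∀ c {a b} → b < a → T (belowStep c a b)
  belowStep-< c {a} {b} b<a with <-cmp b a
  ... | tri< _ _ _    = _
  ... | tri≈ b≮a _ _  = contradiction b<a b≮a
  ... | tri> b≮a _ _  = contradiction b<a b≮a

  belowStep-≡ : ∀ {c} a → T c → T (belowStep c a a)
  belowStep-≡ a t with <-cmp a a
  ... | tri< _ a≢a _  = contradiction refl a≢a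
  ... | tri≈ _ _ _    = t
  ... | tri> _ a≢a _  = contradiction refl a≢a

  pattern pairing c = just (just c)
  pattern padding   = just nothing

  descentStep : Maybe (Maybe Bool) → A × Maybe A → Maybe (Maybe Bool)
  descentStep (pairing c) (a , just b)  = pairing (belowStep c a b)
  descentStep (pairing c) (a , nothing) = padding
  descentStep padding     (a , nothing) = padding
  descentStep _           _             = nothing

  descentAccept : Maybe (Maybe Bool) → Bool
  descentAccept (pairing c) = c
  descentAccept padding     = true
  descentAccept nothing     = false

  descent : Automaton (A × Maybe A)
  descent = record
    { State  = Maybe (Maybe Bool)
    ; finite = Maybe-finite (Maybe-finite Bool-finite)
    ; start  = pairing false
    ; step   = descentStep
    ; accept = descentAccept
    }

  private
    runD = Automaton.run descent

  runD-sink : ∀ w → runD nothing w ≡ nothing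
  runD-sink []      = refl
  runD-sink (_ ∷ w) = runD-sink w

  padding-sound : ∀ w → T (descentAccept (runD padding w)) → Σ ℕ λ k → map proj₂ w ≡ replicate k nothing
  padding-sound []                  _ = zero , refl
  padding-sound ((_ , nothing) ∷ w) t with padding-sound w t
  ... | k , eq = suc k , cong (nothing ∷_) eq
  padding-sound ((_ , just _) ∷ w)  t rewrite runD-sink w = contradiction t λ ()

  padding-complete : ∀ w k → map proj₂ w ≡ replicate k nothing → runD padding w ≡ padding
  padding-complete []                  _       _  = refl
  padding-complete ((_ , nothing) ∷ w) (suc k) eq = padding-complete w k (proj₂ (∷-injective eq))

  -- What acceptance from the state pairing c certifies.
  Below : Bool → List A → List A → Set ℓ
  Below c v u = length v ℕ.< length u ⊎ v <ʳ u ⊎ (v ≡ u × T c)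

  descent-sound : ∀ c w → T (descentAccept (runD (pairing c) w)) →
    Σ (List A) λ v → Σ ℕ λ k → map proj₂ w ≡ map just v ++ replicate k nothing × Below c v (map proj₁ w)
  descent-sound c []                  t = [] , zero , refl , inj₂ (inj₂ (refl , t))
  descent-sound c ((a , nothing) ∷ w) t with padding-sound w t
  ... | k , eq = [] , suc k , cong (nothing ∷_) eq , inj₁ (s≤s z≤n)
  descent-sound c ((a , just b) ∷ w)  t with descent-sound (belowStep c a b) w t
  ... | v , k , eq , below = b ∷ v , k , cong (just b ∷_) eq , below∷ below
    where
    below∷ : Below (belowStep c a b) v (map proj₁ w) → Below c (b ∷ v) (a ∷ map proj₁ w)
    below∷ (inj₁ |v|<|u|)           = inj₁ (s≤s |v|<|u|)
    below∷ (inj₂ (inj₁ v<u))        = inj₂ (inj₁ (tail< v<u))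
    below∷ (inj₂ (inj₂ (refl , t′))) with belowStep-sound c a b t′
    ... | inj₁ b<a         = inj₂ (inj₁ (head< b<a))
    ... | inj₂ (refl , tc) = inj₂ (inj₂ (refl , tc))

  descent-complete : ∀ c w v k → map proj₂ w ≡ map just v ++ replicate k nothing →
    Below c v (map proj₁ w) → T (descentAccept (runD (pairing c) w))
  descent-complete c []      []      zero    refl (inj₂ (inj₂ (_ , t))) = t
  descent-complete c (_ ∷ w) []      (suc k) eq   _ with ∷-injective eq
  ... | refl , eq′ rewrite padding-complete w k eq′ = _
  descent-complete c ((a , _) ∷ w) (b ∷ v) k eq below with ∷-injective eq
  ... | refl , eq′ = descent-complete (belowStep c a b) w v k eq′ (below∷ below)
    where
    below∷ : Below c (b ∷ v) (a ∷ map proj₁ w) → Below (belowStep c a b) v (map proj₁ w)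
    below∷ (inj₁ (s≤s |v|<|u|))        = inj₁ |v|<|u|
    below∷ (inj₂ (inj₁ (tail< v<u)))   = inj₂ (inj₁ v<u)
    below∷ (inj₂ (inj₁ (head< b<a)))   = inj₂ (inj₂ (refl , belowStep-< c b<a))
    below∷ (inj₂ (inj₂ (refl , t)))    = inj₂ (inj₂ (refl , belowStep-≡ a t))

  Lang-descent : ∀ w → Lang descent w ⇔ Descent w
  Lang-descent w = mk⇔ to from
    where
    to : Lang descent w → Descent w
    to t with descent-sound false w t
    ... | v , k , eq , inj₁ |v|<|u|      = v , k , eq , inj₁ |v|<|u|
    ... | v , k , eq , inj₂ (inj₁ v<u)   = v , k , eq , inj₂ (<ʳ-length v<u , v<u)
    from : Descent w → Lang descent w
    from (v , k , eq , inj₁ |v|<|u|)      = descent-complete false w v k eq (inj₁ |v|<|u|)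
    from (v , k , eq , inj₂ (_ , v<u))    = descent-complete false w v k eq (inj₂ (inj₁ v<u))

  Descent-regular : Regular Descent
  Descent-regular = recognised⇒regular descent Lang-descent


module NormalForms {W : Set} {_≺_ : Rel W ℓ} (≺-wellFounded : WellFounded _≺_)
                   (≺-trichotomy : ∀ u v → u ≺ v ⊎ u ≡ v ⊎ v ≺ u)
                   {_~_ : Rel W ℓ′} (~-isEquivalence : IsEquivalence _~_) where
  open IsEquivalence ~-isEquivalence renaming (refl to ~-refl; sym to ~-sym; trans to ~-trans)

  Reducible : Pred W _
  Reducible u = ∃ λ v → v ≺ u × v ~ u

  irreducible-unique : ∀ {u v} → ¬ Reducible u → ¬ Reducible v → u ~ v → u ≡ v
  irreducible-unique {u} {v} irr-u irr-v u~v with ≺-trichotomy u v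
  ... | inj₁ u≺v        = contradiction (u , u≺v , u~v) irr-v
  ... | inj₂ (inj₁ u≡v) = u≡v
  ... | inj₂ (inj₂ v≺u) = contradiction (v , v≺u , ~-sym u~v) irr-u

  irreducible-exists : Decidable Reducible → ∀ u → ∃ λ v → ¬ Reducible v × v ~ u
  irreducible-exists reducible? u = descend u (≺-wellFounded u)
    where
    descend : ∀ u → Acc _≺_ u → ∃ λ v → ¬ Reducible v × v ~ u
    descend u (acc rs) with reducible? u
    ... | no irr = u , irr , ~-refl
    ... | yes (v , v≺u , v~u) with descend v (rs v≺u)
    ...   | w , irr , w~v = w , irr , ~-trans w~v v~u

module WordProblem {c ℓ} (G : Group c ℓ) {n : ℕ} (gens : Fin n → Group.Carrier G) where
  open Group G using (_≈_; setoid; isEquivalence; identityˡ; ∙-congˡ)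
    renaming (refl to ≈-refl; sym to ≈-sym; trans to ≈-trans)
  open import Relation.Binary.Reasoning.Setoid setoid
  open Shortlex (Fin.<-cmp {n}) Fin.<-wellFounded public

  open NormalForms ≺-wellFounded ≺-trichotomy (On.isEquivalence (evalΣ G gens) isEquivalence) public

  evalE-padded : ∀ r k → evalE G gens (map just r ++ replicate k nothing) ≈ evalΣ G gens r
  evalE-padded []      zero    = ≈-refl
  evalE-padded []      (suc k) = ≈-trans (identityˡ _) (evalE-padded [] k)
  evalE-padded (a ∷ r) k       = ∙-congˡ (evalE-padded r k)

  reducible⇔ : ∀ u → Reducible u ⇔ Image proj₁ (Lrel G gens ∩ Descent) u
  reducible⇔ u = mk⇔ to from
    where
    to : Reducible u → Image proj₁ (Lrel G gens ∩ Descent) u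
    to (v , v≺u , v~u) = pad u v , (lrel , descent-pad v≺u) , sym (pad-proj₁ u v)
      where
      lrel : Lrel G gens (pad u v)
      lrel rewrite pad-proj₁ u v | pad-proj₂ u v (≺⇒length≤ v≺u) = begin
        evalΣ G gens u                                                      ≈⟨ v~u ⟨
        evalΣ G gens v                                                      ≈⟨ evalE-padded v _ ⟨
        evalE G gens (map just v ++ replicate _ nothing)                    ∎
    from : Image proj₁ (Lrel G gens ∩ Descent) u → Reducible u
    from (w , (lrel , v , k , w₂≡ , v≺) , refl) = v , v≺ , (begin
      evalΣ G gens v                                      ≈⟨ evalE-padded v k ⟨
      evalE G gens (map just v ++ replicate k nothing)    ≡⟨ cong (evalE G gens) w₂≡ ⟨
      evalE G gens (map proj₂ w)                          ≈⟨ lrel ⟨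
      evalΣ G gens (map proj₁ w)                          ∎)

  pairs-finite : Finite (Fin n × Maybe (Fin n))
  pairs-finite = ×-finite (Fin-finite n) (Maybe-finite (Fin-finite n))

  letter≟ : DecidableEquality (Maybe (Fin n))
  letter≟ = Maybe.≡-dec Fin._≟_

  pair≟ : DecidableEquality (Maybe (Fin n) × Maybe (Fin n))
  pair≟ = Product.≡-dec letter≟ letter≟

  reducible-regular : Regular (Lrel G gens) → Regular Reducible
  reducible-regular lrel = Regular-resp (⇔-sym ∘ reducible⇔)
    (Regular-image pairs-finite proj₁ Fin._≟_ (Regular-∩ lrel Descent-regular))

  EqualInG : Pred (List (Maybe (Fin n) × Maybe (Fin n))) ℓ
  EqualInG w = evalE G gens (map proj₁ w) ≈ evalE G gens (map proj₂ w)

  embed₁ embed₂ : Fin n × Maybe (Fin n) → Maybe (Fin n) × Maybe (Fin n)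
  embed₁ = map₁ just
  embed₂ = swap ∘ map₁ just

  Lrel⇔EqualInG-embed₁ : ∀ w → Lrel G gens w ⇔ EqualInG (map embed₁ w)
  Lrel⇔EqualInG-embed₁ w rewrite sym (map-∘ {g = proj₁} {f = embed₁} w)
                               | sym (map-∘ {g = proj₂} {f = embed₁} w)
                               | map-∘ {g = just} {f = proj₁} w = mk⇔ id id

  Lrel⇔EqualInG-embed₂ : ∀ w → Lrel G gens w ⇔ EqualInG (map embed₂ w)
  Lrel⇔EqualInG-embed₂ w rewrite sym (map-∘ {g = proj₁} {f = embed₂} w)
                               | sym (map-∘ {g = proj₂} {f = embed₂} w)
                               | map-∘ {g = just} {f = proj₁} w = mk⇔ ≈-sym ≈-sym

  embed₁-onto : ∀ w u → map proj₁ w ≡ map just u → Σ _ λ w′ → w ≡ map embed₁ w′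
  embed₁-onto []                   []      _  = [] , refl
  embed₁-onto ((just a , y) ∷ w)   (b ∷ u) eq with embed₁-onto w u (proj₂ (∷-injective eq))
  ... | w′ , refl = (a , y) ∷ w′ , refl

  embed₂-onto : ∀ w u → map proj₂ w ≡ map just u → Σ _ λ w′ → w ≡ map embed₂ w′
  embed₂-onto []                   []      _  = [] , refl
  embed₂-onto ((x , just a) ∷ w)   (b ∷ u) eq with embed₂-onto w u (proj₂ (∷-injective eq))
  ... | w′ , refl = (a , x) ∷ w′ , refl

  normalForm : Decidable Reducible →
    (Ared : DFA (Fin n)) → (∀ u → Accepts Ared u ⇔ (¬ Reducible u)) →
    ∀ {γ} w → evalΣ G gens w ≈ γ → Σ (List (Fin n)) λ u →
    (Accepts Ared u × evalΣ G gens u ≈ γ) ×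
    (∀ u′ → Accepts Ared u′ → evalΣ G gens u′ ≈ γ → u′ ≡ u)
  normalForm reducible? Ared accepts⇔irreducible w w≈γ with irreducible-exists reducible? w
  ... | u , irr , u~w = u , (Equivalence.from (accepts⇔irreducible u) irr , u≈γ) , unique
    where
    u≈γ = ≈-trans u~w w≈γ
    unique : ∀ u′ → Accepts Ared u′ → evalΣ G gens u′ ≈ _ → u′ ≡ u
    unique u′ u′∈ u′≈γ =
      irreducible-unique (Equivalence.to (accepts⇔irreducible u′) u′∈) irr (≈-trans u′≈γ (≈-sym u≈γ))

  module Multiplier (Ared : DFA (Fin n)) (g : Fin n) where

    Shapes : Pred (List (Maybe (Fin n) × Maybe (Fin n))) _
    Shapes w = (InRedG G Ared g (map proj₁ w) × InRedPad G Ared (map proj₂ w))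
             ⊎ (InRedGPad G Ared g (map proj₁ w) × InRed G Ared (map proj₂ w))

    map-just-∷ʳ : ∀ r → map just (r ∷ʳ g) ≡ map just r ++ just g ∷ []
    map-just-∷ʳ r = map-++ just r (g ∷ [])

    Lmult⇔ : ∀ w → Lmult G gens Ared g w ⇔
      (Shapes w × (Image embed₁ (Lrel G gens) w ⊎ Image embed₂ (Lrel G gens) w))
    Lmult⇔ w = mk⇔ to from
      where
      to : Lmult G gens Ared g w → _
      to (shape@(inj₁ ((r , _ , w₁≡) , _)) , eq)
        with embed₁-onto w (r ∷ʳ g) (trans w₁≡ (sym (map-just-∷ʳ r)))
      ... | w′ , refl = shape , inj₁ (w′ , Equivalence.from (Lrel⇔EqualInG-embed₁ w′) eq , refl)
      to (shape@(inj₂ (_ , (r , _ , w₂≡))) , eq) with embed₂-onto w r w₂≡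
      ... | w′ , refl = shape , inj₂ (w′ , Equivalence.from (Lrel⇔EqualInG-embed₂ w′) eq , refl)
      from : _ → Lmult G gens Ared g w
      from (shape , inj₁ (w′ , l , refl)) = shape , Equivalence.to (Lrel⇔EqualInG-embed₁ w′) l
      from (shape , inj₂ (w′ , l , refl)) = shape , Equivalence.to (Lrel⇔EqualInG-embed₂ w′) l

    InRedG⇔ : ∀ x → InRedG G Ared g x ⇔ Image just (Snoc (Accepts Ared) g) x
    InRedG⇔ x = mk⇔
      (λ (r , r∈ , x≡) → r ∷ʳ g , (r , r∈ , refl) , trans x≡ (sym (map-just-∷ʳ r)))
      (λ { (_ , (r , r∈ , refl) , x≡) → r , r∈ , trans x≡ (map-just-∷ʳ r) })

    InRedGPad⇔ : ∀ x → InRedGPad G Ared g x ⇔ Padded (Snoc (Accepts Ared) g) x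
    InRedGPad⇔ x = mk⇔
      (λ (r , k , r∈ , x≡) → r ∷ʳ g , k , (r , r∈ , refl) , trans x≡ (sym (padded-∷ʳ r k)))
      (λ { (_ , k , (r , r∈ , refl) , x≡) → r , k , r∈ , trans x≡ (padded-∷ʳ r k) })
      where
      padded-∷ʳ : ∀ r k →
        map just (r ∷ʳ g) ++ replicate k nothing ≡ map just r ++ just g ∷ replicate k nothing
      padded-∷ʳ r k = trans (cong (_++ replicate k nothing) (map-just-∷ʳ r))
                            (++-assoc (map just r) (just g ∷ []) (replicate k nothing))

    Shapes-regular : Regular Shapes
    Shapes-regular =
      Regular-∪ (Regular-∩ (Regular-preimage proj₁ InRedG-regular)
                           (Regular-preimage proj₂ InRedPad-regular))
                (Regular-∩ (Regular-preimage proj₁ InRedGPad-regular)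
                           (Regular-preimage proj₂ InRed-regular))
      where
      Ared·g-regular : Regular (Snoc (Accepts Ared) g)
      Ared·g-regular = Regular-snoc Fin._≟_ g (Regular-Accepts Ared)
      InRedG-regular : Regular (InRedG G Ared g)
      InRedG-regular =
        Regular-resp (⇔-sym ∘ InRedG⇔) (Regular-image (Fin-finite n) just letter≟ Ared·g-regular)
      InRedPad-regular : Regular (InRedPad G Ared)
      InRedPad-regular = Regular-padded (Regular-Accepts Ared)
      InRedGPad-regular : Regular (InRedGPad G Ared g)
      InRedGPad-regular = Regular-resp (⇔-sym ∘ InRedGPad⇔) (Regular-padded Ared·g-regular)
      InRed-regular : Regular (InRed G Ared)
      InRed-regular = Regular-image (Fin-finite n) just letter≟ (Regular-Accepts Ared)

    Lmult-regular : Regular (Lrel G gens) → Regular (Lmult G gens Ared g)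
    Lmult-regular lrel = Regular-resp (⇔-sym ∘ Lmult⇔)
      (Regular-∩ Shapes-regular (Regular-∪ (Regular-image pairs-finite embed₁ pair≟ lrel)
                                           (Regular-image pairs-finite embed₂ pair≟ lrel)))

mainTheorem5 : ∀ {c ℓ ℓ′} (G : Group c ℓ) (Γ : Pred (Group.Carrier G) ℓ′) →
    IsSubSemigroup G Γ → StronglyAutomatic G Γ → Automatic G Γ
mainTheorem5 G Γ _ (n , gens , generating , lrel) = automatic (Regular-∁ (reducible-regular lrel))
  where
  open WordProblem G gens

  automatic : Regular (∁ Reducible) → Automatic G Γ
  automatic (Ared , accepts⇔irreducible) =
    n , gens , generating , Ared ,
    (λ γ γ∈Γ → let w , _ , w≈γ = IsGeneratingSet.generates generating γ γ∈Γ in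
               normalForm (Regular-decidable (reducible-regular lrel)) Ared accepts⇔irreducible w w≈γ) ,
    (λ g → Multiplier.Lmult-regular Ared g lrel)
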